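{- For every odd integer $t \geq 3$ and every positive integer $k \equiv 0 \pmod 4$, the graph $K_{k+1} \times K_t$ has a partial $C_k$-factorization.
   Context: For graphs $G,H$, the tensor product $G \times H$ has vertex set $V(G)\times V(H)$, with $(g_1,h_1)$ adjacent to $(g_2,h_2)$ iff $g_1g_2 \in E(G)$ and $h_1h_2 \in E(H)$. $K_n$ is the complete graph on $n$ vertices. $K_{u} \times K_t$ is regarded as a $u$-partite graph with partite sets $V_i = \{i\}\times V(K_t)$. A partial $C_k$-factor of $K_u \times K_t$ is a subgraph which, for some $i$, is a spanning subgraph of $(K_u \times K_t)\setminus V_i$ all of whose components are cycles of length $k$; a partial $C_k$-factorization is a partition of the edge set into partial $C_k$-factors. -}

module Defs where

open import Data.Nat using (ℕ; zero; suc; _≤_; _%_)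
open import Data.Nat.DivMod using (m%n<n)
open import Data.Fin using (Fin; toℕ; fromℕ<)
open import Data.Product using (Σ; _×_; _,_; proj₁; proj₂; ∃; ∃-syntax)
open import Data.Sum using (_⊎_)
open import Relation.Binary.PropositionalEquality using (_≡_; _≢_)
open import Function.Definitions using (Injective)

-- Vertices of K_u × K_t : pairs (i , j) with i ∈ V(K_u), j ∈ V(K_t).
-- The partite set V_i consists of the vertices with first coordinate i.
Vtx : ℕ → ℕ → Set
Vtx u t = Fin u × Fin t

Adj : ∀ {u t} → Vtx u t → Vtx u t → Set
Adj (g₁ , h₁) (g₂ , h₂) = (g₁ ≢ g₂) × (h₁ ≢ h₂)

next : ∀ {k} → Fin k → Fin k
next {suc n} p = fromℕ< (m%n<n (suc (toℕ p)) (suc n))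

record IsCycle (u t k : ℕ) (vs : Fin k → Vtx u t) : Set where
  field
    length≥3 : 3 ≤ k
    distinct : Injective _≡_ _≡_ vs
    adjacent : ∀ p → Adj (vs p) (vs (next p))

-- A partial C_k-factor of K_u × K_t: for some part i, a spanning subgraph of
-- (K_u × K_t) ∖ V_i all of whose components are cycles of length k; i.e. a
-- collection of pairwise vertex-disjoint k-cycles of K_u × K_t covering
-- exactly the vertices outside V_i.
record PartialCkFactor (u t k : ℕ) : Set where
  field
    missing  : Fin u
    ncycles  : ℕ
    cyc      : Fin ncycles → Fin k → Vtx u t
    isCycle  : ∀ c → IsCycle u t k (cyc c)
    disjoint : ∀ c c' p p' → cyc c p ≡ cyc c' p' → c ≡ c'
    avoids   : ∀ c p → proj₁ (cyc c p) ≢ missing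
    spans    : ∀ (v : Vtx u t) → proj₁ v ≢ missing → ∃[ c ] ∃[ p ] (cyc c p ≡ v)

EdgeIn : ∀ {u t k} → PartialCkFactor u t k → Vtx u t → Vtx u t → Set
EdgeIn F x y =
  ∃[ c ] ∃[ p ] ((cyc c p ≡ x × cyc c (next p) ≡ y) ⊎ (cyc c p ≡ y × cyc c (next p) ≡ x))
  where open PartialCkFactor F

record PartialCkFactorization (u t k : ℕ) : Set where
  field
    nfactors : ℕ
    factor   : Fin nfactors → PartialCkFactor u t k
    covers   : ∀ x y → Adj x y → ∃[ f ] EdgeIn (factor f) x y
    unique   : ∀ x y → Adj x y → ∀ f f' →
               EdgeIn (factor f) x y → EdgeIn (factor f') x y → f ≡ f'

-- Since 4 ∣ k there is a k-cycle C = (a₀, …, a_{k-1}) in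
-- ℤ_(k+1) whose edges, each oriented from its even-indexed to its odd-indexed end, have pairwise
-- distinct differences (a Rosa-type labelling); the k+1 translates C + i then contain every ordered
-- pair of distinct residues exactly once as an arc, and C + i misses exactly one residue.  As t = 2D+1,
-- every pair of distinct residues of ℤ_t differs by exactly one of ±1, …, ±D.  For each i and each
-- shift s ∈ {1, …, D}, the t cycles p ↦ (a_p + i, c) (p even), p ↦ (a_p + i, c + s) (p odd), c ∈ ℤ_t,
-- form a partial C_k-factor, and every edge of K_(k+1) × K_t lies in exactly one of these factors.
module Submission where

open import Defs
open import Data.Nat using (ℕ; zero; suc; _+_; _∸_; _*_; _≤_; _<_; z≤n; s≤s; ⌊_/2⌋)
open import Data.Nat.Properties as ℕ using (+-suc)
open import Data.Nat.DivMod using (_mod_; _%_; m%n<n; m<n⇒m%n≡m; %-distribˡ-+; n%n≡0)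
open import Data.Nat.Divisibility using (_∣_; divides)
open import Data.Nat.Tactic.RingSolver using (solve-∀)
open import Data.Bool using (Bool; true; false; not; if_then_else_)
open import Data.Fin as Fin using (Fin; toℕ; fromℕ<; punchOut; combine; remQuot)
open import Data.Fin.Properties
  using (toℕ-fromℕ<; toℕ-injective; toℕ<n; any?; _≟_; punchOut-injective; injective⇒≤;
         remQuot-combine; combine-remQuot)
open import Data.Product using (_,_; _×_; proj₁; proj₂; ∃-syntax; map; uncurry)
open import Data.Product.Properties using (,-injectiveˡ; ,-injectiveʳ)
open import Data.Sum using (_⊎_; inj₁; inj₂)
open import Data.Empty using (⊥; ⊥-elim)
open import Function using (_∘_)
open import Function.Definitions using (Injective)
open import Level using (0ℓ)
open import Relation.Binary.PropositionalEquality hiding ([_])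
open import Relation.Nullary using (¬_; yes; no; contradiction)
open import Algebra.Core using (Op₁; Op₂)
open import Algebra.Bundles using (AbelianGroup)
open import Algebra.Structures using (IsAbelianGroup)
import Algebra.Properties.AbelianGroup as AbelianGroupProperties
import Algebra.Properties.CommutativeSemigroup as CommutativeSemigroupProperties

injective⇒onto : ∀ {n} {f : Fin n → Fin n} → Injective _≡_ _≡_ f → ∀ y → ∃[ x ] f x ≡ y
injective⇒onto {suc m} {f} f-inj y with any? (λ x → f x ≟ y)
... | yes hit = hit
... | no miss = contradiction (injective⇒≤ g-inj) ℕ.1+n≰n
  where
    y≢f : ∀ x → y ≢ f x
    y≢f x e = miss (x , sym e)

    g : Fin (suc m) → Fin m
    g x = punchOut (y≢f x)

    g-inj : Injective _≡_ _≡_ g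
    g-inj = f-inj ∘ punchOut-injective (y≢f _) (y≢f _)

injective-avoiding⇒onto : ∀ {m} {f : Fin m → Fin (suc m)} {hole} → Injective _≡_ _≡_ f →
                          (∀ x → f x ≢ hole) → ∀ y → y ≢ hole → ∃[ x ] f x ≡ y
injective-avoiding⇒onto {m} {f} {hole} f-inj f≢hole y y≢hole =
  let x , gx≡gy = injective⇒onto g-inj (punchOut (y≢hole ∘ sym))
  in x , punchOut-injective {i = hole} _ _ gx≡gy
  where
    g : Fin m → Fin m
    g x = punchOut (f≢hole x ∘ sym)

    g-inj : Injective _≡_ _≡_ g
    g-inj = f-inj ∘ punchOut-injective {i = hole} _ _

isEven : ℕ → Bool
isEven zero    = true
isEven (suc n) = not (isEven n)

isEven-double : ∀ n → isEven (n + n) ≡ true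
isEven-double zero = refl
isEven-double (suc n) rewrite +-suc n n | isEven-double n = refl

parity : ∀ n → ∃[ q ] (n ≡ q + q ⊎ n ≡ suc (q + q))
parity zero = 0 , inj₁ refl
parity (suc n) with parity n
... | q , inj₁ refl = q , inj₂ refl
... | q , inj₂ refl = suc q , inj₁ (cong suc (sym (+-suc q q)))

odd≢even : ∀ a b → suc (a + a) ≢ b + b
odd≢even a b e with trans (sym (cong not (isEven-double a))) (trans (cong isEven e) (isEven-double b))
... | ()

double-injective : ∀ {a b} → a + a ≡ b + b → a ≡ b
double-injective {a} {b} e = trans (ℕ.n≡⌊n+n/2⌋ a) (trans (cong ⌊_/2⌋ e) (sym (ℕ.n≡⌊n+n/2⌋ b)))

double-<-cancel : ∀ {a b} → a + a < b + b → a < b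
double-<-cancel {a} {b} lt with a ℕ.<? b
... | yes a<b = a<b
... | no a≮b  = contradiction (ℕ.+-mono-≤ (ℕ.≮⇒≥ a≮b) (ℕ.≮⇒≥ a≮b)) (ℕ.<⇒≱ lt)

⌊suc[n+n]/2⌋≡n : ∀ n → ⌊ suc (n + n) /2⌋ ≡ n
⌊suc[n+n]/2⌋≡n zero = refl
⌊suc[n+n]/2⌋≡n (suc n) rewrite +-suc n n = cong suc (⌊suc[n+n]/2⌋≡n n)

next-view : ∀ {k} (p : Fin k) →
            toℕ (next p) ≡ suc (toℕ p) ⊎ (suc (toℕ p) ≡ k × toℕ (next p) ≡ 0)
next-view {suc k} p with suc (toℕ p) ℕ.<? suc k
... | yes lt = inj₁ (trans (toℕ-fromℕ< _) (m<n⇒m%n≡m lt))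
... | no ≮   = inj₂ (wrap , trans (toℕ-fromℕ< _) (trans (cong (_% suc k) wrap) (n%n≡0 (suc k))))
  where
    wrap : suc (toℕ p) ≡ suc k
    wrap = ℕ.≤-antisym (toℕ<n p) (ℕ.≮⇒≥ ≮)

next≢ : ∀ {k} → 2 ≤ k → (p : Fin k) → next p ≢ p
next≢ 2≤k p next≡p with next-view p
... | inj₁ e        = ℕ.1+n≢n (trans (sym e) (cong toℕ next≡p))
... | inj₂ (wrap , e) =
  ℕ.<⇒≱ 2≤k (ℕ.≤-reflexive (trans (sym wrap) (cong suc (trans (sym (cong toℕ next≡p)) e))))

isEven-next : ∀ {k} → isEven k ≡ true → (p : Fin k) → isEven (toℕ (next p)) ≡ not (isEven (toℕ p))
isEven-next k-even p with next-view p
... | inj₁ e          = cong isEven e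
... | inj₂ (wrap , e) = trans (cong isEven e) (sym (trans (cong isEven wrap) k-even))

-- Cyclic groups

module Cyclic (m : ℕ) where

  N : ℕ
  N = suc m

  infixl 6 _⊕_
  _⊕_ : Op₂ (Fin N)
  x ⊕ y = (toℕ x + toℕ y) mod N

  ⊖_ : Op₁ (Fin N)
  ⊖ x = (N ∸ toℕ x) mod N

  toℕ-mod : ∀ a → toℕ (a mod N) ≡ a % N
  toℕ-mod a = toℕ-fromℕ< (m%n<n a N)

  mod-toℕ : ∀ x → toℕ x mod N ≡ x
  mod-toℕ x = toℕ-injective (trans (toℕ-mod (toℕ x)) (m<n⇒m%n≡m (toℕ<n x)))

  mod-cong : ∀ a b → a % N ≡ b % N → a mod N ≡ b mod N
  mod-cong a b e = toℕ-injective (trans (toℕ-mod a) (trans e (sym (toℕ-mod b))))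

  mod-injective : ∀ {a b} → a < N → b < N → a mod N ≡ b mod N → a ≡ b
  mod-injective {a} {b} a<N b<N e = begin
    a             ≡⟨ m<n⇒m%n≡m a<N ⟨
    a % N         ≡⟨ toℕ-mod a ⟨
    toℕ (a mod N) ≡⟨ cong toℕ e ⟩
    toℕ (b mod N) ≡⟨ toℕ-mod b ⟩
    b % N         ≡⟨ m<n⇒m%n≡m b<N ⟩
    b             ∎
    where open ≡-Reasoning

  mod-+ : ∀ a b → (a + b) mod N ≡ a mod N ⊕ b mod N
  mod-+ a b = trans (mod-cong (a + b) (a % N + b % N) (%-distribˡ-+ a b N))
                    (sym (cong₂ (λ u v → (u + v) mod N) (toℕ-mod a) (toℕ-mod b)))

  ⊕-assoc : ∀ x y z → (x ⊕ y) ⊕ z ≡ x ⊕ (y ⊕ z)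
  ⊕-assoc x y z = begin
    (X + Y) mod N ⊕ z        ≡⟨ cong ((X + Y) mod N ⊕_) (mod-toℕ z) ⟨
    (X + Y) mod N ⊕ Z mod N  ≡⟨ mod-+ (X + Y) Z ⟨
    (X + Y + Z) mod N        ≡⟨ cong (_mod N) (ℕ.+-assoc X Y Z) ⟩
    (X + (Y + Z)) mod N      ≡⟨ mod-+ X (Y + Z) ⟩
    X mod N ⊕ (Y + Z) mod N  ≡⟨ cong (_⊕ (Y + Z) mod N) (mod-toℕ x) ⟩
    x ⊕ (Y + Z) mod N        ∎
    where
      open ≡-Reasoning
      X Y Z : ℕ
      X = toℕ x
      Y = toℕ y
      Z = toℕ z

  ⊕-comm : ∀ x y → x ⊕ y ≡ y ⊕ x
  ⊕-comm x y = cong (_mod N) (ℕ.+-comm (toℕ x) (toℕ y))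

  ⊕-identityˡ : ∀ x → Fin.zero ⊕ x ≡ x
  ⊕-identityˡ = mod-toℕ

  ⊕-inverseˡ : ∀ x → ⊖ x ⊕ x ≡ Fin.zero
  ⊕-inverseˡ x = begin
    (N ∸ X) mod N ⊕ x        ≡⟨ cong ((N ∸ X) mod N ⊕_) (mod-toℕ x) ⟨
    (N ∸ X) mod N ⊕ X mod N  ≡⟨ mod-+ (N ∸ X) X ⟨
    (N ∸ X + X) mod N        ≡⟨ cong (_mod N) (ℕ.m∸n+n≡m (ℕ.<⇒≤ (toℕ<n x))) ⟩
    N mod N                  ≡⟨ mod-cong N 0 (n%n≡0 N) ⟩
    Fin.zero                 ∎
    where
      open ≡-Reasoning
      X : ℕ
      X = toℕ x

  isAbelianGroup : IsAbelianGroup _≡_ _⊕_ Fin.zero ⊖_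
  isAbelianGroup = record
    { isGroup = record
      { isMonoid = record
        { isSemigroup = record
          { isMagma = record { isEquivalence = isEquivalence ; ∙-cong = cong₂ _⊕_ }
          ; assoc   = ⊕-assoc
          }
        ; identity = ⊕-identityˡ , λ x → trans (⊕-comm x Fin.zero) (⊕-identityˡ x)
        }
      ; inverse = ⊕-inverseˡ , λ x → trans (⊕-comm x (⊖ x)) (⊕-inverseˡ x)
      ; ⁻¹-cong = cong ⊖_
      }
    ; comm = ⊕-comm
    }

-- Products of cycle systems and shift systems

Arc : ∀ {A : Set} {k} → (Fin k → A) → Bool → Fin k → A × A
Arc f true  p = f p , f (next p)
Arc f false p = f (next p) , f p

Arc-∘ : ∀ {A B : Set} {k} (g : A → B) (f : Fin k → A) b p → Arc (g ∘ f) b p ≡ map g g (Arc f b p)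
Arc-∘ g f true  p = refl
Arc-∘ g f false p = refl

Arc⇒step : ∀ {A : Set} {k} (f : Fin k → A) b p {x y} → Arc f b p ≡ (x , y) →
           (f p ≡ x × f (next p) ≡ y) ⊎ (f p ≡ y × f (next p) ≡ x)
Arc⇒step f true  p refl = inj₁ (refl , refl)
Arc⇒step f false p refl = inj₂ (refl , refl)

step⇒Arc : ∀ {A : Set} {k} (f : Fin k → A) b p {x y} →
           (f p ≡ x × f (next p) ≡ y) ⊎ (f p ≡ y × f (next p) ≡ x) →
           Arc f b p ≡ (x , y) ⊎ Arc f b p ≡ (y , x)
step⇒Arc f true  p (inj₁ (refl , refl)) = inj₁ refl
step⇒Arc f true  p (inj₂ (refl , refl)) = inj₂ refl
step⇒Arc f false p (inj₁ (refl , refl)) = inj₂ refl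
step⇒Arc f false p (inj₂ (refl , refl)) = inj₁ refl

EdgeIn-sym : ∀ {u t k} (F : PartialCkFactor u t k) {x y} → EdgeIn F x y → EdgeIn F y x
EdgeIn-sym F (c , p , inj₁ e) = c , p , inj₂ e
EdgeIn-sym F (c , p , inj₂ e) = c , p , inj₁ e

record CycleSystem (n k : ℕ) : Set where
  field
    cycle           : Fin n → Fin k → Fin n
    forward         : Fin k → Bool
    forward-next    : ∀ p → forward (next p) ≡ not (forward p)
    cycle-injective : ∀ i → Injective _≡_ _≡_ (cycle i)
    cycle-avoids    : ∀ i p → cycle i p ≢ i
    arc-onto        : ∀ x y → x ≢ y → ∃[ i ] ∃[ p ] Arc (cycle i) (forward p) p ≡ (x , y)
    arc-unique      : ∀ i j p q → Arc (cycle i) (forward p) p ≡ Arc (cycle j) (forward q) q → i ≡ j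

record ShiftSystem (t D : ℕ) : Set where
  field
    shift            : Fin D → Fin t → Fin t
    shift-injective  : ∀ d → Injective _≡_ _≡_ (shift d)
    shift-connects   : ∀ y z → y ≢ z → (∃[ d ] shift d y ≡ z) ⊎ (∃[ d ] shift d z ≡ y)
    shift-unique     : ∀ d e y → shift d y ≡ shift e y → d ≡ e
    shift-asymmetric : ∀ d e y → shift e (shift d y) ≢ y

module Product {k t D : ℕ} (3≤k : 3 ≤ k) (C : CycleSystem (suc k) k) (S : ShiftSystem t D) where
  open CycleSystem C
  open ShiftSystem S

  rowOf : Fin D → Fin t → Bool → Fin t
  rowOf d c b = if b then c else shift d c

  vertex : Fin (suc k) → Fin D → Fin t → Fin k → Vtx (suc k) t
  vertex i d c p = cycle i p , rowOf d c (forward p)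

  shift-fixpointFree : ∀ d c → shift d c ≢ c
  shift-fixpointFree d c e = shift-asymmetric d d c (trans (cong (shift d) e) e)

  Arc-vertex : ∀ i d c p → Arc (vertex i d c) (forward p) p ≡
    ((proj₁ (Arc (cycle i) (forward p) p) , c) , (proj₂ (Arc (cycle i) (forward p) p) , shift d c))
  Arc-vertex i d c p with forward p in eq
  ... | true  rewrite forward-next p | eq = refl
  ... | false rewrite forward-next p | eq = refl

  rowOf-injective : ∀ d b {c c'} → rowOf d c b ≡ rowOf d c' b → c ≡ c'
  rowOf-injective d true  e = e
  rowOf-injective d false e = shift-injective d e

  rowOf-onto : ∀ d b y → ∃[ c ] rowOf d c b ≡ y
  rowOf-onto d true  y = y , refl
  rowOf-onto d false y = injective⇒onto (shift-injective d) y

  rowOf-next : ∀ d c p → rowOf d c (forward p) ≢ rowOf d c (forward (next p))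
  rowOf-next d c p rewrite forward-next p with forward p
  ... | true  = shift-fixpointFree d c ∘ sym
  ... | false = shift-fixpointFree d c

  isCycle : ∀ i d c → IsCycle (suc k) t k (vertex i d c)
  isCycle i d c = record
    { length≥3 = 3≤k
    ; distinct = cycle-injective i ∘ ,-injectiveˡ
    ; adjacent = λ p → next≢ (ℕ.<⇒≤ 3≤k) p ∘ cycle-injective i ∘ sym , rowOf-next d c p
    }

  factor : Fin (suc k) → Fin D → PartialCkFactor (suc k) t k
  factor i d = record
    { missing  = i
    ; ncycles  = t
    ; cyc      = vertex i d
    ; isCycle  = isCycle i d
    ; disjoint = disjoint
    ; avoids   = λ _ → cycle-avoids i
    ; spans    = spans
    }
    where
      disjoint : ∀ c c' p p' → vertex i d c p ≡ vertex i d c' p' → c ≡ c'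
      disjoint c c' p p' e with cycle-injective i (,-injectiveˡ e)
      ... | refl = rowOf-injective d (forward p) (,-injectiveʳ e)

      spans : ∀ v → proj₁ v ≢ i → ∃[ c ] ∃[ p ] vertex i d c p ≡ v
      spans (x , y) x≢i =
        let p , cp≡x = injective-avoiding⇒onto (cycle-injective i) (cycle-avoids i) x x≢i
            c , r≡y  = rowOf-onto d (forward p) y
        in c , p , cong₂ _,_ cp≡x r≡y

  ForwardEdge : Fin (suc k) → Fin D → Vtx (suc k) t → Vtx (suc k) t → Set
  ForwardEdge i d (x , y) (x' , y') = (∃[ p ] Arc (cycle i) (forward p) p ≡ (x , x')) × shift d y ≡ y'

  ForwardEdge⇒EdgeIn : ∀ {i d u v} → ForwardEdge i d u v → EdgeIn (factor i d) u v
  ForwardEdge⇒EdgeIn {i} {d} {x , y} ((p , a) , s) =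
    y , p , Arc⇒step (vertex i d y) (forward p) p
              (trans (Arc-vertex i d y p) (cong₂ _,_ (cong (_, y) (cong proj₁ a)) (cong₂ _,_ (cong proj₂ a) s)))

  Arc-vertex⇒ForwardEdge : ∀ {i d} c p {u v} → Arc (vertex i d c) (forward p) p ≡ (u , v) → ForwardEdge i d u v
  Arc-vertex⇒ForwardEdge {i} {d} c p a with trans (sym (Arc-vertex i d c p)) a
  ... | refl = (p , refl) , refl

  EdgeIn⇒ForwardEdge : ∀ {i d u v} → EdgeIn (factor i d) u v → ForwardEdge i d u v ⊎ ForwardEdge i d v u
  EdgeIn⇒ForwardEdge {i} {d} (c , p , step) with step⇒Arc (vertex i d c) (forward p) p step
  ... | inj₁ a = inj₁ (Arc-vertex⇒ForwardEdge c p a)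
  ... | inj₂ a = inj₂ (Arc-vertex⇒ForwardEdge c p a)

  ForwardEdge-unique : ∀ {i j d e u v} → ForwardEdge i d u v → ForwardEdge j e u v → (i , d) ≡ (j , e)
  ForwardEdge-unique {i} {j} {d} {e} {x , y} ((p , a) , s) ((q , a') , s') =
    cong₂ _,_ (arc-unique i j p q (trans a (sym a'))) (shift-unique d e y (trans s (sym s')))

  ForwardEdge-asymmetric : ∀ {i j d e u v} → ForwardEdge i d u v → ForwardEdge j e v u → ⊥
  ForwardEdge-asymmetric {d = d} {e} {x , y} (_ , s) (_ , s') =
    shift-asymmetric d e y (trans (cong (shift e) s) s')

  edge-covered : ∀ u v → Adj u v → ∃[ i ] ∃[ d ] EdgeIn (factor i d) u v
  edge-covered (x , y) (x' , y') (x≢x' , y≢y') with shift-connects y y' y≢y'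
  ... | inj₁ (d , s) = let i , p , a = arc-onto x x' x≢x' in i , d , ForwardEdge⇒EdgeIn ((p , a) , s)
  ... | inj₂ (d , s) = let i , p , a = arc-onto x' x (x≢x' ∘ sym) in
                       i , d , EdgeIn-sym (factor i d) (ForwardEdge⇒EdgeIn ((p , a) , s))

  edge-unique : ∀ {u v} (a b : Fin (suc k) × Fin D) →
                EdgeIn (uncurry factor a) u v → EdgeIn (uncurry factor b) u v → a ≡ b
  edge-unique (i , d) (j , e) E E' with EdgeIn⇒ForwardEdge E | EdgeIn⇒ForwardEdge E'
  ... | inj₁ f | inj₁ f' = ForwardEdge-unique f f'
  ... | inj₂ f | inj₂ f' = ForwardEdge-unique f f'
  ... | inj₁ f | inj₂ f' = ⊥-elim (ForwardEdge-asymmetric f f')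
  ... | inj₂ f | inj₁ f' = ⊥-elim (ForwardEdge-asymmetric f' f)

  factorization : PartialCkFactorization (suc k) t k
  factorization = record
    { nfactors = suc k * D
    ; factor   = uncurry factor ∘ remQuot D
    ; covers   = λ u v adj →
        let i , d , E = edge-covered u v adj
        in combine i d , subst (λ a → EdgeIn (uncurry factor a) u v) (sym (remQuot-combine i d)) E
    ; unique   = λ u v _ f f' E E' → begin
        f                               ≡⟨ combine-remQuot D f ⟨
        uncurry combine (remQuot D f)   ≡⟨ cong (uncurry combine) (edge-unique (remQuot D f) (remQuot D f') E E') ⟩
        uncurry combine (remQuot D f')  ≡⟨ combine-remQuot D f' ⟩
        f'                              ∎
    }
    where open ≡-Reasoning

-- Difference cycles and half sets

module DifferenceCycle {k} {add : Op₂ (Fin (suc k))} {zero : Fin (suc k)} {neg : Op₁ (Fin (suc k))}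
                       (isAbelianGroup : IsAbelianGroup _≡_ add zero neg)
                       (label : Fin k → Fin (suc k)) where

  G : AbelianGroup 0ℓ 0ℓ
  G = record { isAbelianGroup = isAbelianGroup }
  open AbelianGroup G using (_∙_; ε; _⁻¹; _-_; assoc; comm; identityʳ; inverseʳ)
  open AbelianGroupProperties G
    using (∙-cancelˡ; ∙-cancelʳ; //-rightDividesˡ; //-rightDividesʳ; x∙y⁻¹≈ε⇒x≈y; ⁻¹-∙-comm)
  open CommutativeSemigroupProperties (AbelianGroup.commutativeSemigroup G) using (interchange)

  forward : Fin k → Bool
  forward p = isEven (toℕ p)

  arc : Fin k → Fin (suc k) × Fin (suc k)
  arc p = Arc label (forward p) p

  displacement : Fin (suc k) × Fin (suc k) → Fin (suc k)
  displacement (x , y) = y - x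

  difference : Fin k → Fin (suc k)
  difference = displacement ∘ arc

  translate : Fin (suc k) → Fin (suc k) × Fin (suc k) → Fin (suc k) × Fin (suc k)
  translate τ = map (_∙ τ) (_∙ τ)

  displacement-translate : ∀ τ u → displacement (translate τ u) ≡ displacement u
  displacement-translate τ (x , y) = begin
    (y ∙ τ) ∙ (x ∙ τ) ⁻¹     ≡⟨ cong ((y ∙ τ) ∙_) (⁻¹-∙-comm x τ) ⟨
    (y ∙ τ) ∙ (x ⁻¹ ∙ τ ⁻¹)  ≡⟨ interchange y τ (x ⁻¹) (τ ⁻¹) ⟩
    (y ∙ x ⁻¹) ∙ (τ ∙ τ ⁻¹)  ≡⟨ cong ((y - x) ∙_) (inverseʳ τ) ⟩
    (y - x) ∙ ε              ≡⟨ identityʳ (y - x) ⟩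
    y - x                    ∎
    where open ≡-Reasoning

  translate-onto : ∀ u v → displacement u ≡ displacement v → translate (proj₁ v - proj₁ u) u ≡ v
  translate-onto (a , b) (x , y) e = cong₂ _,_ (trans (comm a (x - a)) (//-rightDividesˡ a x)) (begin
    b ∙ (x ∙ a ⁻¹)  ≡⟨ cong (b ∙_) (comm x (a ⁻¹)) ⟩
    b ∙ (a ⁻¹ ∙ x)  ≡⟨ assoc b (a ⁻¹) x ⟨
    (b - a) ∙ x     ≡⟨ cong (_∙ x) e ⟩
    (y - x) ∙ x     ≡⟨ //-rightDividesˡ x y ⟩
    y               ∎)
    where open ≡-Reasoning

  displacement-Arc≡ε : ∀ b p → displacement (Arc label b p) ≡ ε → label p ≡ label (next p)
  displacement-Arc≡ε true  p e = sym (x∙y⁻¹≈ε⇒x≈y _ _ e)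
  displacement-Arc≡ε false p e = x∙y⁻¹≈ε⇒x≈y _ _ e

  module _ (2≤k : 2 ≤ k) (k-even : isEven k ≡ true) (hole : Fin (suc k))
           (label-injective : Injective _≡_ _≡_ label) (label≢hole : ∀ p → label p ≢ hole)
           (difference-injective : Injective _≡_ _≡_ difference) where

    cycle : Fin (suc k) → Fin k → Fin (suc k)
    cycle i = (_∙ (i - hole)) ∘ label

    Arc-cycle : ∀ i p → Arc (cycle i) (forward p) p ≡ translate (i - hole) (arc p)
    Arc-cycle i p = Arc-∘ (_∙ (i - hole)) label (forward p) p

    hole-translate : ∀ i → hole ∙ (i - hole) ≡ i
    hole-translate i = trans (comm hole (i - hole)) (//-rightDividesˡ hole i)

    difference≢ε : ∀ p → difference p ≢ ε
    difference≢ε p = next≢ 2≤k p ∘ sym ∘ label-injective ∘ displacement-Arc≡ε (forward p) p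

    arc-onto : ∀ x y → x ≢ y → ∃[ i ] ∃[ p ] Arc (cycle i) (forward p) p ≡ (x , y)
    arc-onto x y x≢y with injective-avoiding⇒onto difference-injective difference≢ε (y - x)
                                                  (x≢y ∘ sym ∘ x∙y⁻¹≈ε⇒x≈y y x)
    ... | p , d≡ = τ ∙ hole , p , (begin
      Arc (cycle (τ ∙ hole)) (forward p) p  ≡⟨ Arc-cycle (τ ∙ hole) p ⟩
      translate (τ ∙ hole - hole) (arc p)   ≡⟨ cong (λ σ → translate σ (arc p)) (//-rightDividesʳ hole τ) ⟩
      translate τ (arc p)                   ≡⟨ translate-onto (arc p) (x , y) d≡ ⟩
      (x , y)                               ∎)
      where
        open ≡-Reasoning
        τ : Fin (suc k)
        τ = x - proj₁ (arc p)

    same-difference : ∀ i j p q → Arc (cycle i) (forward p) p ≡ Arc (cycle j) (forward q) q →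
                      difference p ≡ difference q
    same-difference i j p q e = begin
      difference p                                ≡⟨ displacement-translate (i - hole) (arc p) ⟨
      displacement (translate (i - hole) (arc p))
        ≡⟨ cong displacement (trans (sym (Arc-cycle i p)) (trans e (Arc-cycle j q))) ⟩
      displacement (translate (j - hole) (arc q)) ≡⟨ displacement-translate (j - hole) (arc q) ⟩
      difference q                                ∎
      where open ≡-Reasoning

    arc-unique : ∀ i j p q → Arc (cycle i) (forward p) p ≡ Arc (cycle j) (forward q) q → i ≡ j
    arc-unique i j p q e with difference-injective {p} {q} (same-difference i j p q e)
    ... | refl = ∙-cancelʳ (hole ⁻¹) i j
                   (∙-cancelˡ (proj₁ (arc p)) (i - hole) (j - hole)
                     (cong proj₁ (trans (sym (Arc-cycle i p)) (trans e (Arc-cycle j p)))))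

    cycleSystem : CycleSystem (suc k) k
    cycleSystem = record
      { cycle           = cycle
      ; forward         = forward
      ; forward-next    = isEven-next k-even
      ; cycle-injective = λ i → label-injective ∘ ∙-cancelʳ (i - hole) _ _
      ; cycle-avoids    = λ i p e → label≢hole p (∙-cancelʳ (i - hole) _ _ (trans e (sym (hole-translate i))))
      ; arc-onto        = arc-onto
      ; arc-unique      = arc-unique
      }

module HalfSet {t} {add : Op₂ (Fin t)} {zero : Fin t} {neg : Op₁ (Fin t)}
               (isAbelianGroup : IsAbelianGroup _≡_ add zero neg) where

  G : AbelianGroup 0ℓ 0ℓ
  G = record { isAbelianGroup = isAbelianGroup }
  open AbelianGroup G using (_∙_; ε; _⁻¹; _-_; assoc; comm; identityʳ)
  open AbelianGroupProperties G using (∙-cancelˡ; ∙-cancelʳ; //-rightDividesˡ; x∙y⁻¹≈ε⇒x≈y; ⁻¹-anti-homo‿-)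

  shiftSystem : ∀ {D} (half : Fin D → Fin t) → Injective _≡_ _≡_ half →
                (∀ d e → half d ∙ half e ≢ ε) →
                (∀ z → z ≢ ε → (∃[ d ] half d ≡ z) ⊎ (∃[ d ] half d ≡ z ⁻¹)) →
                ShiftSystem t D
  shiftSystem {D} half half-injective half-asymmetric half-covers = record
    { shift            = shift
    ; shift-injective  = λ d → ∙-cancelʳ (half d) _ _
    ; shift-connects   = connects
    ; shift-unique     = λ d e y → half-injective ∘ ∙-cancelˡ y (half d) (half e)
    ; shift-asymmetric = λ d e y eq → half-asymmetric d e (∙-cancelˡ y _ _
                           (trans (sym (assoc y (half d) (half e))) (trans eq (sym (identityʳ y)))))
    }
    where
      shift : Fin D → Fin t → Fin t
      shift d y = y ∙ half d

      lands : ∀ {d} y z → half d ≡ z - y → shift d y ≡ z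
      lands y z e = trans (cong (y ∙_) e) (trans (comm y (z - y)) (//-rightDividesˡ y z))

      connects : ∀ y z → y ≢ z → (∃[ d ] shift d y ≡ z) ⊎ (∃[ d ] shift d z ≡ y)
      connects y z y≢z with half-covers (z - y) (y≢z ∘ sym ∘ x∙y⁻¹≈ε⇒x≈y z y)
      ... | inj₁ (d , e) = inj₁ (d , lands y z e)
      ... | inj₂ (d , e) = inj₂ (d , lands z y (trans e (⁻¹-anti-homo‿- z y)))

module LowerHalf (D : ℕ) where
  open Cyclic (D + D)

  half : Fin D → Fin N
  half d = suc (toℕ d) mod N

  half<N : ∀ d → suc (toℕ d) < N
  half<N d = s≤s (ℕ.m≤n⇒m≤n+o D (toℕ<n d))

  half-injective : Injective _≡_ _≡_ half
  half-injective e = toℕ-injective (ℕ.suc-injective (mod-injective (half<N _) (half<N _) e))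

  half-asymmetric : ∀ d e → half d ⊕ half e ≢ Fin.zero
  half-asymmetric d e sum≡0 =
    ℕ.1+n≢0 (mod-injective (s≤s (ℕ.+-mono-≤ (toℕ<n d) (toℕ<n e))) (s≤s z≤n)
              (trans (mod-+ (suc (toℕ d)) (suc (toℕ e))) sum≡0))

  half-onto : ∀ v → 0 < v → v ≤ D → ∃[ d ] half d ≡ v mod N
  half-onto (suc v) _ v<D = fromℕ< v<D , cong (λ u → suc u mod N) (toℕ-fromℕ< v<D)

  half-covers : ∀ z → z ≢ Fin.zero → (∃[ d ] half d ≡ z) ⊎ (∃[ d ] half d ≡ ⊖ z)
  half-covers Fin.zero z≢0 = contradiction refl z≢0
  half-covers (Fin.suc y) _ with suc (toℕ y) ℕ.≤? D
  ... | yes z≤D = let d , e = half-onto (suc (toℕ y)) (s≤s z≤n) z≤D in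
                  inj₁ (d , trans e (mod-toℕ (Fin.suc y)))
  ... | no z≰D  = inj₂ (half-onto (D + D ∸ toℕ y) (ℕ.m<n⇒0<n∸m (toℕ<n y))
                          (ℕ.≤-trans (ℕ.∸-monoʳ-≤ (D + D) (ℕ.≤-pred (ℕ.≰⇒> z≰D)))
                                     (ℕ.≤-reflexive (ℕ.m+n∸n≡m D D))))

  shiftSystem : ShiftSystem N D
  shiftSystem = HalfSet.shiftSystem isAbelianGroup half half-injective half-asymmetric half-covers

-- A Rosa-type labelling

-- In ℤ_(4h+1): a_{2q} = -q and a_{2q+1} = q+1 (q < h), q+2 (q ≥ h).
-- The difference on the edge at position P is P+1 (P < 2h), P+2 (2h ≤ P < 4h-1) and 2h+1 (P = 4h-1).
module RosaLabelling (h : ℕ) (0<h : 0 < h) where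

  m k : ℕ
  m = h + h
  k = m + m

  open Cyclic k

  G : AbelianGroup 0ℓ 0ℓ
  G = record { isAbelianGroup = isAbelianGroup }
  open AbelianGroup G using (inverseʳ)
  open AbelianGroupProperties G using (⁻¹-involutive; ⁻¹-injective)

  [_] : ℕ → Fin N
  [ a ] = a mod N

  oddLabel : ℕ → ℕ
  oddLabel q with q ℕ.<? h
  ... | yes _ = suc q
  ... | no _  = suc (suc q)

  oddLabel-cases : ∀ q → (q < h × oddLabel q ≡ suc q) ⊎ (h ≤ q × oddLabel q ≡ suc (suc q))
  oddLabel-cases q with q ℕ.<? h
  ... | yes q<h = inj₁ (q<h , refl)
  ... | no q≮h  = inj₂ (ℕ.≮⇒≥ q≮h , refl)

  labelAt : ℕ → Fin N
  labelAt P = if isEven P then ⊖ [ ⌊ P /2⌋ ] else [ oddLabel ⌊ P /2⌋ ]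

  labelAt-even : ∀ q → labelAt (q + q) ≡ ⊖ [ q ]
  labelAt-even q rewrite isEven-double q = cong (⊖_ ∘ [_]) (sym (ℕ.n≡⌊n+n/2⌋ q))

  labelAt-odd : ∀ q → labelAt (suc (q + q)) ≡ [ oddLabel q ]
  labelAt-odd q rewrite isEven-double q = cong ([_] ∘ oddLabel) (⌊suc[n+n]/2⌋≡n q)

  label : Fin k → Fin N
  label = labelAt ∘ toℕ

  hole : Fin N
  hole = [ suc h ]

  1≤m : 1 ≤ m
  1≤m = ℕ.≤-trans 0<h (ℕ.m≤m+n h h)

  suc-h≤m : suc h ≤ m
  suc-h≤m = ℕ.+-monoˡ-≤ h 0<h

  3≤k : 3 ≤ k
  3≤k = ℕ.≤-trans (ℕ.n≤1+n 3) (ℕ.+-mono-≤ (ℕ.+-mono-≤ 0<h 0<h) (ℕ.+-mono-≤ 0<h 0<h))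

  <m⇒<N : ∀ {a} → a < m → a < N
  <m⇒<N a<m = ℕ.<-trans (ℕ.<-≤-trans a<m (ℕ.m≤m+n m m)) (ℕ.n<1+n k)

  odd-index<m : ∀ q → suc (q + q) < k → q < m
  odd-index<m q = double-<-cancel ∘ ℕ.<-trans (ℕ.n<1+n (q + q))

  oddLabel≤ : ∀ q → oddLabel q ≤ suc (suc q)
  oddLabel≤ q with oddLabel-cases q
  ... | inj₁ (_ , e) = ℕ.≤-trans (ℕ.≤-reflexive e) (ℕ.n≤1+n _)
  ... | inj₂ (_ , e) = ℕ.≤-reflexive e

  0<oddLabel : ∀ q → 0 < oddLabel q
  0<oddLabel q with oddLabel-cases q
  ... | inj₁ (_ , e) = subst (0 <_) (sym e) (s≤s z≤n)
  ... | inj₂ (_ , e) = subst (0 <_) (sym e) (s≤s z≤n)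

  oddLabel<N : ∀ {q} → q < m → oddLabel q < N
  oddLabel<N {q} q<m = s≤s (ℕ.≤-trans (oddLabel≤ q) (ℕ.+-mono-≤ 1≤m q<m))

  branches-disjoint : ∀ {a b} → a < h → h ≤ b → suc a ≢ suc (suc b)
  branches-disjoint a<h h≤b refl = ℕ.<-asym a<h (ℕ.≤-<-trans h≤b (ℕ.n<1+n _))

  oddLabel-injective : ∀ {q q'} → oddLabel q ≡ oddLabel q' → q ≡ q'
  oddLabel-injective {q} {q'} e with oddLabel-cases q | oddLabel-cases q'
  ... | inj₁ (_ , e₁) | inj₁ (_ , e₂) = ℕ.suc-injective (trans (sym e₁) (trans e e₂))
  ... | inj₂ (_ , e₁) | inj₂ (_ , e₂) = ℕ.suc-injective (ℕ.suc-injective (trans (sym e₁) (trans e e₂)))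
  ... | inj₁ (q<h , e₁) | inj₂ (h≤q' , e₂) =
    contradiction (trans (sym e₁) (trans e e₂)) (branches-disjoint q<h h≤q')
  ... | inj₂ (h≤q , e₁) | inj₁ (q'<h , e₂) =
    contradiction (trans (sym e₂) (trans (sym e) e₁)) (branches-disjoint q'<h h≤q)

  oddLabel≢suc-h : ∀ q → oddLabel q ≢ suc h
  oddLabel≢suc-h q e with oddLabel-cases q
  ... | inj₁ (q<h , e₁) = ℕ.<⇒≢ q<h (ℕ.suc-injective (trans (sym e₁) e))
  ... | inj₂ (h≤q , e₁) = ℕ.<⇒≱ (ℕ.≤-reflexive (ℕ.suc-injective (trans (sym e₁) e))) h≤q

  ⊖[]≢[] : ∀ a b → 0 < a + b → a + b < N → ⊖ [ a ] ≢ [ b ]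
  ⊖[]≢[] a b 0<a+b a+b<N e = ℕ.<⇒≢ 0<a+b (sym (mod-injective a+b<N (s≤s z≤n) (begin
    [ a + b ]        ≡⟨ mod-+ a b ⟩
    [ a ] ⊕ [ b ]    ≡⟨ cong ([ a ] ⊕_) e ⟨
    [ a ] ⊕ ⊖ [ a ]  ≡⟨ inverseʳ [ a ] ⟩
    Fin.zero         ∎)))
    where open ≡-Reasoning

  even≢odd : ∀ {q q'} → q < m → q' < m → ⊖ [ q ] ≢ [ oddLabel q' ]
  even≢odd {q} {q'} q<m q'<m =
    ⊖[]≢[] q (oddLabel q') (ℕ.<-≤-trans (0<oddLabel q') (ℕ.m≤n+m _ q)) (s≤s sum≤k)
    where
      sum≤k : q + oddLabel q' ≤ k
      sum≤k = ℕ.≤-trans (ℕ.+-monoʳ-≤ q (oddLabel≤ q'))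
                (ℕ.≤-trans (ℕ.≤-reflexive (+-suc q (suc q'))) (ℕ.+-mono-≤ q<m q'<m))

  labelAt-injective : ∀ {P P'} → P < k → P' < k → labelAt P ≡ labelAt P' → P ≡ P'
  labelAt-injective {P} {P'} P<k P'<k e with parity P | parity P'
  ... | q , inj₁ refl | q' , inj₁ refl =
    cong (λ a → a + a) (mod-injective (<m⇒<N (double-<-cancel {q} P<k)) (<m⇒<N (double-<-cancel {q'} P'<k))
      (⁻¹-injective (trans (sym (labelAt-even q)) (trans e (labelAt-even q')))))
  ... | q , inj₂ refl | q' , inj₂ refl =
    cong (λ a → suc (a + a)) (oddLabel-injective
      (mod-injective (oddLabel<N (odd-index<m q P<k)) (oddLabel<N (odd-index<m q' P'<k))
        (trans (sym (labelAt-odd q)) (trans e (labelAt-odd q')))))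
  ... | q , inj₁ refl | q' , inj₂ refl =
    ⊥-elim (even≢odd (double-<-cancel {q} P<k) (odd-index<m q' P'<k)
      (trans (sym (labelAt-even q)) (trans e (labelAt-odd q'))))
  ... | q , inj₂ refl | q' , inj₁ refl =
    ⊥-elim (even≢odd (double-<-cancel {q'} P'<k) (odd-index<m q P<k)
      (trans (sym (labelAt-even q')) (trans (sym e) (labelAt-odd q))))

  label-injective : Injective _≡_ _≡_ label
  label-injective = toℕ-injective ∘ labelAt-injective (toℕ<n _) (toℕ<n _)

  label≢hole : ∀ p → label p ≢ hole
  label≢hole p e with parity (toℕ p)
  ... | q , inj₁ P≡ = ⊖[]≢[] q (suc h) (ℕ.<-≤-trans (s≤s z≤n) (ℕ.m≤n+m _ q)) (s≤s sum≤k)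
                        (trans (sym (labelAt-even q)) (trans (cong labelAt (sym P≡)) e))
    where
      q<m : q < m
      q<m = double-<-cancel {q} (subst (_< k) P≡ (toℕ<n p))

      sum≤k : q + suc h ≤ k
      sum≤k = ℕ.≤-trans (ℕ.≤-reflexive (+-suc q h)) (ℕ.+-mono-≤ q<m (ℕ.m≤m+n h h))
  ... | q , inj₂ P≡ = oddLabel≢suc-h q (mod-injective (oddLabel<N q<m) (s≤s (ℕ.≤-trans suc-h≤m (ℕ.m≤m+n m m)))
                        (trans (sym (labelAt-odd q)) (trans (cong labelAt (sym P≡)) e)))
    where
      q<m : q < m
      q<m = odd-index<m q (subst (_< k) P≡ (toℕ<n p))

  open DifferenceCycle isAbelianGroup label using (displacement; difference; cycleSystem)

  displacement-even-odd : ∀ q o → displacement (⊖ [ q ] , [ o ]) ≡ [ o + q ]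
  displacement-even-odd q o = trans (cong ([ o ] ⊕_) (⁻¹-involutive [ q ])) (sym (mod-+ o q))

  difference-forward : ∀ p q → toℕ p ≡ q + q → toℕ (next p) ≡ suc (q + q) →
                       difference p ≡ [ oddLabel q + q ]
  difference-forward p q P≡ next≡ = begin
    displacement (Arc label (isEven (toℕ p)) p)
      ≡⟨ cong (λ b → displacement (Arc label b p)) (trans (cong isEven P≡) (isEven-double q)) ⟩
    displacement (label p , label (next p))
      ≡⟨ cong₂ (λ x y → displacement (x , y)) (trans (cong labelAt P≡) (labelAt-even q))
                                              (trans (cong labelAt next≡) (labelAt-odd q)) ⟩
    displacement (⊖ [ q ] , [ oddLabel q ])
      ≡⟨ displacement-even-odd q (oddLabel q) ⟩
    [ oddLabel q + q ] ∎
    where open ≡-Reasoning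

  difference-backward : ∀ p q q' → toℕ p ≡ suc (q + q) → toℕ (next p) ≡ q' + q' →
                        difference p ≡ [ oddLabel q + q' ]
  difference-backward p q q' P≡ next≡ = begin
    displacement (Arc label (isEven (toℕ p)) p)
      ≡⟨ cong (λ b → displacement (Arc label b p)) (trans (cong isEven P≡) (cong not (isEven-double q))) ⟩
    displacement (label (next p) , label p)
      ≡⟨ cong₂ (λ x y → displacement (x , y)) (trans (cong labelAt next≡) (labelAt-even q'))
                                              (trans (cong labelAt P≡) (labelAt-odd q)) ⟩
    displacement (⊖ [ q' ] , [ oddLabel q ])
      ≡⟨ displacement-even-odd q' (oddLabel q) ⟩
    [ oddLabel q + q' ] ∎
    where open ≡-Reasoning

  Gap : ℕ → ℕ → Set
  Gap P g = (P < m × g ≡ suc P) ⊎ (m ≤ P × suc P < k × g ≡ suc (suc P)) ⊎ (suc P ≡ k × g ≡ suc m)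

  Gap<N : ∀ {P g} → Gap P g → g < N
  Gap<N (inj₁ (P<m , refl))             = s≤s (ℕ.≤-trans P<m (ℕ.m≤m+n m m))
  Gap<N (inj₂ (inj₁ (_ , sP<k , refl))) = s≤s sP<k
  Gap<N (inj₂ (inj₂ (_ , refl)))        = s≤s (ℕ.+-monoˡ-≤ m 1≤m)

  private
    gap₁₂ : ∀ {P P'} → P < m → m ≤ P' → suc P ≢ suc (suc P')
    gap₁₂ {P' = P'} P<m m≤P' e =
      ℕ.<-asym P<m (ℕ.≤-<-trans m≤P' (subst (P' <_) (sym (ℕ.suc-injective e)) (ℕ.n<1+n P')))

    gap₁₃ : ∀ {P} → P < m → suc P ≢ suc m
    gap₁₃ P<m e = ℕ.<-irrefl (ℕ.suc-injective e) P<m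

    gap₂₃ : ∀ {P} → m ≤ P → suc (suc P) ≢ suc m
    gap₂₃ m≤P e = ℕ.<-irrefl (sym (ℕ.suc-injective e)) (s≤s m≤P)

  Gap-injective : ∀ {P P' g} → Gap P g → Gap P' g → P ≡ P'
  Gap-injective (inj₁ (_ , refl)) (inj₁ (_ , e)) = ℕ.suc-injective e
  Gap-injective (inj₂ (inj₁ (_ , _ , refl))) (inj₂ (inj₁ (_ , _ , e))) =
    ℕ.suc-injective (ℕ.suc-injective e)
  Gap-injective (inj₂ (inj₂ (w , _))) (inj₂ (inj₂ (w' , _))) = ℕ.suc-injective (trans w (sym w'))
  Gap-injective (inj₁ (P<m , refl)) (inj₂ (inj₁ (m≤P' , _ , e))) = ⊥-elim (gap₁₂ P<m m≤P' e)
  Gap-injective (inj₂ (inj₁ (m≤P , _ , refl))) (inj₁ (P'<m , e)) = ⊥-elim (gap₁₂ P'<m m≤P (sym e))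
  Gap-injective (inj₁ (P<m , refl)) (inj₂ (inj₂ (_ , e))) = ⊥-elim (gap₁₃ P<m e)
  Gap-injective (inj₂ (inj₂ (_ , refl))) (inj₁ (P'<m , e)) = ⊥-elim (gap₁₃ P'<m (sym e))
  Gap-injective (inj₂ (inj₁ (m≤P , _ , refl))) (inj₂ (inj₂ (_ , e))) = ⊥-elim (gap₂₃ m≤P e)
  Gap-injective (inj₂ (inj₂ (_ , refl))) (inj₂ (inj₁ (m≤P' , _ , e))) = ⊥-elim (gap₂₃ m≤P' (sym e))

  last-index : ∀ q → suc (suc (q + q)) ≡ k → suc q ≡ m
  last-index q wrap = double-injective (trans (cong suc (+-suc q q)) wrap)

  last-oddLabel : ∀ q → suc (suc (q + q)) ≡ k → oddLabel q + 0 ≡ suc m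
  last-oddLabel q wrap with oddLabel-cases q
  ... | inj₁ (q<h , _) = ⊥-elim (ℕ.<⇒≱ q<h (ℕ.≤-pred (subst (suc h ≤_) (sym (last-index q wrap)) suc-h≤m)))
  ... | inj₂ (_ , e)   = trans (ℕ.+-identityʳ _) (trans e (cong suc (last-index q wrap)))

  difference-gap : ∀ p → ∃[ g ] difference p ≡ [ g ] × Gap (toℕ p) g
  difference-gap p with parity (toℕ p) | next-view p
  ... | q , inj₁ P≡ | inj₂ (wrap , _) = ⊥-elim (odd≢even q m (trans (cong suc (sym P≡)) wrap))
  ... | q , inj₁ P≡ | inj₁ next≡ =
    oddLabel q + q , difference-forward p q P≡ (trans next≡ (cong suc P≡)) , gap
    where
      gap : Gap (toℕ p) (oddLabel q + q)
      gap with oddLabel-cases q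
      ... | inj₁ (q<h , e) = inj₁ ( subst (_< m) (sym P≡) (ℕ.+-mono-< q<h q<h)
                                 , trans (cong (_+ q) e) (cong suc (sym P≡)) )
      ... | inj₂ (h≤q , e) = inj₂ (inj₁ ( subst (m ≤_) (sym P≡) (ℕ.+-mono-≤ h≤q h≤q)
                                        , subst (_< k) next≡ (toℕ<n (next p))
                                        , trans (cong (_+ q) e) (cong (suc ∘ suc) (sym P≡)) ))
  ... | q , inj₂ P≡ | inj₁ next≡ =
    oddLabel q + suc q ,
    difference-backward p q (suc q) P≡ (trans next≡ (cong suc (trans P≡ (sym (+-suc q q))))) , gap
    where
      gap : Gap (toℕ p) (oddLabel q + suc q)
      gap with oddLabel-cases q
      ... | inj₁ (q<h , e) = inj₁ ( subst (_< m) (sym P≡)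
                                        (subst (_≤ m) (cong suc (+-suc q q)) (ℕ.+-mono-≤ q<h q<h))
                                 , trans (cong (_+ suc q) e) (cong suc (trans (+-suc q q) (sym P≡))) )
      ... | inj₂ (h≤q , e) = inj₂ (inj₁ ( subst (m ≤_) (sym P≡) (ℕ.≤-trans (ℕ.+-mono-≤ h≤q h≤q) (ℕ.n≤1+n _))
                                        , subst (_< k) next≡ (toℕ<n (next p))
                                        , trans (cong (_+ suc q) e) (cong (suc ∘ suc) (trans (+-suc q q) (sym P≡))) ))
  ... | q , inj₂ P≡ | inj₂ (wrap , next≡0) =
    oddLabel q + 0 , difference-backward p q 0 P≡ next≡0 ,
    inj₂ (inj₂ (wrap , last-oddLabel q (trans (cong suc (sym P≡)) wrap)))

  difference-injective : Injective _≡_ _≡_ difference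
  difference-injective {p} {p'} e with difference-gap p | difference-gap p'
  ... | g , d≡ , gap | g' , d≡' , gap' =
    toℕ-injective (Gap-injective gap (subst (Gap (toℕ p')) (sym g≡g') gap'))
    where
      g≡g' : g ≡ g'
      g≡g' = mod-injective (Gap<N gap) (Gap<N gap') (trans (sym d≡) (trans e d≡'))

  rosaCycleSystem : CycleSystem N k
  rosaCycleSystem =
    cycleSystem (ℕ.<⇒≤ 3≤k) (isEven-double m) hole label-injective label≢hole difference-injective

factorization : ∀ h D → 0 < h →
                PartialCkFactorization (suc ((h + h) + (h + h))) (suc (D + D)) ((h + h) + (h + h))
factorization h D 0<h =
  Product.factorization (RosaLabelling.3≤k h 0<h) (RosaLabelling.rosaCycleSystem h 0<h)
                        (LowerHalf.shiftSystem D)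

*4≡double-double : ∀ h → h * 4 ≡ (h + h) + (h + h)
*4≡double-double = solve-∀

2∣double : ∀ D → 2 ∣ D + D
2∣double D = divides D (double≡*2 D)
  where
    double≡*2 : ∀ D → D + D ≡ D * 2
    double≡*2 = solve-∀

theorem3p1 : ∀ (t k : ℕ) → 3 ≤ t → ¬ (2 ∣ t) → 0 < k → 4 ∣ k →
    PartialCkFactorization (k + 1) t k
theorem3p1 t _ _ t-odd 0<k (divides h refl) with parity t
... | D , inj₁ refl = contradiction (2∣double D) t-odd
... | D , inj₂ refl rewrite *4≡double-double h | ℕ.+-comm ((h + h) + (h + h)) 1 =
  factorization h D (0<h h 0<k)
  where
    0<h : ∀ h → 0 < (h + h) + (h + h) → 0 < h
    0<h (suc _) _ = s≤s z≤n
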